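{- For all integers $n\ge0$, $\Delta(n)\in\{0,1,2,3\}$. More specifically, for every integer $m\ge 0$: (i) if $s(m)\equiv0$ and $s(m+1)\equiv1\pmod 3$, then $\Delta(2m)=\Delta(2m+1)=0$; (ii) if $s(m)\equiv0$ and $s(m+1)\equiv2\pmod 3$, then $\Delta(2m)=\Delta(2m+1)=3$; (iii) if $s(m)\equiv1\pmod 3$, then $\Delta(2m)=1$ and $\Delta(2m+1)=2$; (iv) if $s(m)\equiv2\pmod 3$, then $\Delta(2m)=2$ and $\Delta(2m+1)=1$.
   Context: The Stern sequence $(s(n))_{n\ge0}$ is defined by $s(0)=0$, $s(1)=1$, $s(2n)=s(n)$, $s(2n+1)=s(n)+s(n+1)$. For $N\ge0$ and $i\in\{1,2\}$, let $T(N;3,i)=|\{n: 0\le n<N,\ s(n)\equiv i\pmod 3\}|$ (so $T(0;3,i)=0$), and let $\Delta(N)=T(N;3,1)-T(N;3,2)$. -}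

module Defs where

open import Data.Nat using (ℕ; zero; suc; _+_; _*_; _%_; _/_)
open import Data.Integer using (ℤ; +_; _-_)
open import Relation.Nullary using (yes; no)
open import Data.Nat using (_≟_)

-- Stern's diatomic sequence, computed with a fuel argument.
-- sternF f n satisfies the recursion s(0)=0, s(1)=1, s(2k)=s(k),
-- s(2k+1)=s(k)+s(k+1) whenever f > n (fuel f = n+1 always suffices,
-- since all recursive calls are on arguments ≤ n/2+1 < n for n ≥ 2).
sternF : ℕ → ℕ → ℕ
sternF zero    n = 0
sternF (suc f) 0 = 0
sternF (suc f) 1 = 1
sternF (suc f) n@(suc (suc _)) with n % 2
... | 0 = sternF f (n / 2)
... | _ = sternF f (n / 2) + sternF f (n / 2 + 1)

s : ℕ → ℕ
s n = sternF (suc n) n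

T : ℕ → ℕ → ℕ
T zero    i = 0
T (suc N) i with s N % 3 ≟ i
... | yes _ = suc (T N i)
... | no  _ = T N i

Δ : ℕ → ℤ
Δ N = + T N 1 - + T N 2

{-# OPTIONS --safe #-}
-- Let χ be the Legendre symbol mod 3, so that Δ (n + 1) = Δ n + χ (s n).  By induction on m,
-- Δ (2m) depends only on the residues of s m and s (m + 1), through the table δ; the inductive
-- step Δ (2m + 2) = Δ (2m) + χ (s m) + χ (s m + s (m + 1)) is a finite check on residues.  When
-- 3 ∣ s (m + 1) this check also needs 3 ∤ s m and 3 ∣ s m + s (m + 2): the former because
-- consecutive Stern numbers are coprime, the latter because s (m + 1) ∣ s m + s (m + 2).
module Submission where

open import Defs
open import Data.Nat using (ℕ; zero; suc; _+_; _*_; _%_; _/_; _≤_; _<_; z≤n; s≤s; _≟_)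
open import Data.Nat.Properties
  using (*-suc; *-comm; +-comm; +-identityʳ; ≤-trans; <-≤-trans; +-monoˡ-≤; +-monoʳ-≤; *-monoʳ-≤; ≤-refl;
         m≤n*m; m≤m+n; n≤1+n; m<m+n; 0≢1+n; m≤n⇒m<n∨m≡n; n≢0⇒n>0; module ≤-Reasoning)
open import Data.Nat.DivMod
  using (m≡m%n+[m/n]*n; m%n<n; m/n<m; m≥n⇒m/n>0; m*n%n≡0; m*n/n≡m; [m+kn]%n≡m%n; +-distrib-/;
         /-congˡ; %-distribˡ-+)
open import Data.Nat.Divisibility using (_∣_; ∣-reflexive; ∣-trans; ∣m∣n⇒∣m+n; n∣m*n; m%n≡0⇒n∣m; n∣m⇒m%n≡0)
open import Data.Nat.Coprimality using (Coprime; coprime-+; 1-coprimeTo) renaming (sym to coprime-sym)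
open import Data.Nat.Induction using (<-rec)
import Data.Nat.Tactic.RingSolver as ℕ
open import Data.Integer using (ℤ; +_; _-_; 0ℤ; 1ℤ; -1ℤ)
import Data.Integer as ℤ using (_+_)
import Data.Integer.Properties as ℤ using (+-identityʳ)
import Data.Integer.Tactic.RingSolver as ℤ
open import Data.Product using (_×_; _,_; proj₁; proj₂)
open import Data.Sum using (_⊎_; inj₁; inj₂)
open import Function using (_∘_; case_of_)
open import Relation.Nullary using (yes; no; contradiction)
open import Relation.Binary.PropositionalEquality

data Parity : ℕ → Set where
  even : ∀ m → Parity (2 * m)
  odd  : ∀ m → Parity (suc (2 * m))

parity : ∀ n → Parity n
parity zero = even 0
parity (suc n) with parity n
... | even m = odd m
... | odd m  = subst Parity (*-suc 2 m) (even (suc m))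

halving-induction : ∀ {ℓ} (P : ℕ → Set ℓ) → P 0 →
                    (∀ m → P (suc m) → P (2 * suc m)) →
                    (∀ m → P m → P (suc (2 * m))) →
                    ∀ n → P n
halving-induction P P0 P-even P-odd = <-rec P step
  where
  step : ∀ n → (∀ {k} → k < n → P k) → P n
  step n rec with parity n
  ... | even zero    = P0
  ... | even (suc m) = P-even m (rec (m<m+n (suc m) (s≤s z≤n)))
  ... | odd m        = P-odd m (rec (s≤s (m≤n*m m 2)))

n/2+1<n : ∀ n → 2 ≤ n → n % 2 ≢ 0 → n / 2 + 1 < n
n/2+1<n n 2≤n n%2≢0 = begin
  suc (n / 2 + 1)           ≡⟨ cong suc (+-comm (n / 2) 1) ⟩
  1 + (1 + n / 2)           ≤⟨ +-monoʳ-≤ 1 (+-monoˡ-≤ (n / 2) (m≥n⇒m/n>0 2≤n)) ⟩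
  1 + (n / 2 + n / 2)       ≡⟨ cong (λ k → 1 + (n / 2 + k)) (sym (+-identityʳ (n / 2))) ⟩
  1 + 2 * (n / 2)           ≤⟨ +-monoˡ-≤ (2 * (n / 2)) (n≢0⇒n>0 n%2≢0) ⟩
  n % 2 + 2 * (n / 2)       ≡⟨ cong (λ k → n % 2 + k) (*-comm 2 (n / 2)) ⟩
  n % 2 + n / 2 * 2         ≡⟨ sym (m≡m%n+[m/n]*n n 2) ⟩
  n                         ∎
  where open ≤-Reasoning

sternF-suc : ∀ f n → n < f → sternF (suc f) n ≡ sternF f n
sternF-suc (suc f) 0 _ = refl
sternF-suc (suc f) 1 _ = refl
sternF-suc (suc f) n@(suc (suc _)) (s≤s n≤f) with n % 2 in n%2≡r
... | zero  = sternF-suc f (n / 2) (<-≤-trans (m/n<m n 2 (s≤s (s≤s z≤n))) n≤f)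
... | suc _ = cong₂ _+_ (sternF-suc f (n / 2) (≤-trans (s≤s (m≤m+n (n / 2) 1)) half+1<f))
                        (sternF-suc f (n / 2 + 1) half+1<f)
  where
  half+1<f : n / 2 + 1 < f
  half+1<f = <-≤-trans (n/2+1<n n (s≤s (s≤s z≤n)) (λ n%2≡0 → 0≢1+n (trans (sym n%2≡0) n%2≡r))) n≤f

sternF≡s : ∀ f n → n < f → sternF f n ≡ s n
sternF≡s (suc f) n (s≤s n≤f) with m≤n⇒m<n∨m≡n n≤f
... | inj₁ n<f = trans (sternF-suc f n n<f) (sternF≡s f n n<f)
... | inj₂ refl = refl

sternF-even : ∀ f n → 2 ≤ n → n % 2 ≡ 0 → sternF (suc f) n ≡ sternF f (n / 2)
sternF-even f (suc (suc k)) (s≤s (s≤s _)) n%2≡0 with suc (suc k) % 2 | n%2≡0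
... | .0 | refl = refl

sternF-odd : ∀ f n → 2 ≤ n → n % 2 ≡ 1 →
             sternF (suc f) n ≡ sternF f (n / 2) + sternF f (n / 2 + 1)
sternF-odd f (suc (suc k)) (s≤s (s≤s _)) n%2≡1 with suc (suc k) % 2 | n%2≡1
... | .1 | refl = refl

2*n%2≡0 : ∀ n → 2 * n % 2 ≡ 0
2*n%2≡0 n = trans (cong (_% 2) (*-comm 2 n)) (m*n%n≡0 n 2)

2*n/2≡n : ∀ n → 2 * n / 2 ≡ n
2*n/2≡n n = trans (/-congˡ (*-comm 2 n)) (m*n/n≡m n 2)

[1+2*n]%2≡1 : ∀ n → suc (2 * n) % 2 ≡ 1
[1+2*n]%2≡1 n = trans (cong (λ k → suc k % 2) (*-comm 2 n)) ([m+kn]%n≡m%n 1 n 2)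

[1+2*n]/2≡n : ∀ n → suc (2 * n) / 2 ≡ n
[1+2*n]/2≡n n = trans (+-distrib-/ 1 (2 * n) (subst (λ k → 1 + k < 2) (sym (2*n%2≡0 n)) ≤-refl)) (2*n/2≡n n)

s[2n]≡s[n] : ∀ n → s (2 * n) ≡ s n
s[2n]≡s[n] zero = refl
s[2n]≡s[n] (suc k) = begin
  sternF (suc (2 * n)) (2 * n)    ≡⟨ sternF-even (2 * n) (2 * n) (*-monoʳ-≤ 2 (s≤s z≤n)) (2*n%2≡0 n) ⟩
  sternF (2 * n) (2 * n / 2)      ≡⟨ cong (sternF (2 * n)) (2*n/2≡n n) ⟩
  sternF (2 * n) n                ≡⟨ sternF≡s (2 * n) n (m<m+n n (s≤s z≤n)) ⟩
  s n                             ∎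
  where
  n = suc k
  open ≡-Reasoning

s[1+2n]≡s[n]+s[1+n] : ∀ n → s (suc (2 * n)) ≡ s n + s (suc n)
s[1+2n]≡s[n]+s[1+n] zero = refl
s[1+2n]≡s[n]+s[1+n] (suc k) = begin
  sternF (suc m) m                          ≡⟨ sternF-odd m m (≤-trans (*-monoʳ-≤ 2 (s≤s z≤n)) (n≤1+n _)) ([1+2*n]%2≡1 n) ⟩
  sternF m (m / 2) + sternF m (m / 2 + 1)   ≡⟨ cong (λ h → sternF m h + sternF m (h + 1)) ([1+2*n]/2≡n n) ⟩
  sternF m n + sternF m (n + 1)             ≡⟨ cong₂ _+_ (sternF≡s m n n<m) (sternF≡s m (n + 1) n+1<m) ⟩
  s n + s (n + 1)                           ≡⟨ cong (λ h → s n + s h) (+-comm n 1) ⟩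
  s n + s (suc n)                           ∎
  where
  n = suc k
  m = suc (2 * n)
  n+1<m : n + 1 < m
  n+1<m = s≤s (subst (_≤ 2 * n) (+-comm 1 n) (m<m+n n (s≤s z≤n)))
  n<m : n < m
  n<m = ≤-trans (s≤s (m≤m+n n 1)) n+1<m
  open ≡-Reasoning

s[n]-coprime-s[1+n] : ∀ n → Coprime (s n) (s (suc n))
s[n]-coprime-s[1+n] = halving-induction (λ n → Coprime (s n) (s (suc n)))
                        (coprime-sym (1-coprimeTo 0)) even-case odd-case
  where
  even-case : ∀ m → Coprime (s (suc m)) (s (suc (suc m))) → Coprime (s (2 * suc m)) (s (suc (2 * suc m)))
  even-case m c = subst₂ Coprime (sym (s[2n]≡s[n] (suc m))) (sym (s[1+2n]≡s[n]+s[1+n] (suc m)))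
                         (coprime-sym (coprime-+ (coprime-sym c)))
  odd-case : ∀ m → Coprime (s m) (s (suc m)) → Coprime (s (suc (2 * m))) (s (suc (suc (2 * m))))
  odd-case m c = subst₂ Coprime (trans (+-comm (s (suc m)) (s m)) (sym (s[1+2n]≡s[n]+s[1+n] m)))
                             (trans (sym (s[2n]≡s[n] (suc m))) (cong s (*-suc 2 m)))
                             (coprime-+ c)

[a+b]+[b+c]≡[a+c]+2b : ∀ a b c → (a + b) + (b + c) ≡ (a + c) + 2 * b
[a+b]+[b+c]≡[a+c]+2b = ℕ.solve-∀

∣[a+b]+[b+c] : ∀ a {b} c → b ∣ a + c → b ∣ (a + b) + (b + c)
∣[a+b]+[b+c] a {b} c b∣a+c = subst (b ∣_) (sym ([a+b]+[b+c]≡[a+c]+2b a b c)) (∣m∣n⇒∣m+n b∣a+c (n∣m*n 2))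

s[1+m]∣s[m]+s[2+m] : ∀ m → s (suc m) ∣ s m + s (suc (suc m))
s[1+m]∣s[m]+s[2+m] = halving-induction (λ m → s (suc m) ∣ s m + s (suc (suc m)))
                       (even-case 0) (λ m _ → even-case (suc m)) odd-case
  where
  s[2+2m]≡s[1+m] : ∀ m → s (suc (suc (2 * m))) ≡ s (suc m)
  s[2+2m]≡s[1+m] m = trans (cong s (sym (*-suc 2 m))) (s[2n]≡s[n] (suc m))
  even-case : ∀ m → s (suc (2 * m)) ∣ s (2 * m) + s (suc (suc (2 * m)))
  even-case m = ∣-reflexive (begin
    s (suc (2 * m))                      ≡⟨ s[1+2n]≡s[n]+s[1+n] m ⟩
    s m + s (suc m)                      ≡⟨ sym (cong₂ _+_ (s[2n]≡s[n] m) (s[2+2m]≡s[1+m] m)) ⟩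
    s (2 * m) + s (suc (suc (2 * m)))    ∎)
    where open ≡-Reasoning
  odd-case : ∀ m → s (suc m) ∣ s m + s (suc (suc m)) →
             s (suc (suc (2 * m))) ∣ s (suc (2 * m)) + s (suc (suc (suc (2 * m))))
  odd-case m ih = subst₂ _∣_ (sym (s[2+2m]≡s[1+m] m))
                    (sym (cong₂ _+_ (s[1+2n]≡s[n]+s[1+n] m)
                                    (trans (cong (s ∘ suc) (sym (*-suc 2 m))) (s[1+2n]≡s[n]+s[1+n] (suc m)))))
                    (∣[a+b]+[b+c] (s m) (s (suc (suc m))) ih)

data Residue₃ : ℕ → Set where
  0₃ : Residue₃ 0
  1₃ : Residue₃ 1
  2₃ : Residue₃ 2

residue₃ : ∀ n → Residue₃ (n % 3)
residue₃ n with n % 3 | m%n<n n 3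
... | 0 | _ = 0₃
... | 1 | _ = 1₃
... | 2 | _ = 2₃
... | suc (suc (suc _)) | s≤s (s≤s (s≤s ()))

neighbours-of-multiple-of-3 : ∀ m → s (suc m) % 3 ≡ 0 →
                              s m % 3 ≢ 0 × (s m % 3 + s (suc (suc m)) % 3) % 3 ≡ 0
neighbours-of-multiple-of-3 m s[1+m]%3≡0 = 3∤s[m] , 3∣s[m]+s[2+m]
  where
  3∣s[1+m] : 3 ∣ s (suc m)
  3∣s[1+m] = m%n≡0⇒n∣m _ 3 s[1+m]%3≡0
  3∤s[m] : s m % 3 ≢ 0
  3∤s[m] s[m]%3≡0 = case s[n]-coprime-s[1+n] m (m%n≡0⇒n∣m _ 3 s[m]%3≡0 , 3∣s[1+m]) of λ ()
  3∣s[m]+s[2+m] : (s m % 3 + s (suc (suc m)) % 3) % 3 ≡ 0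
  3∣s[m]+s[2+m] = trans (sym (%-distribˡ-+ (s m) (s (suc (suc m))) 3))
                        (n∣m⇒m%n≡0 _ 3 (∣-trans 3∣s[1+m] (s[1+m]∣s[m]+s[2+m] m)))

χ : ℕ → ℤ
χ 1 = 1ℤ
χ 2 = -1ℤ
χ _ = 0ℤ

χ-vanishes : ∀ {r} → r ≢ 1 → r ≢ 2 → χ r ≡ 0ℤ
χ-vanishes {0} _ _ = refl
χ-vanishes {1} r≢1 _ = contradiction refl r≢1
χ-vanishes {2} _ r≢2 = contradiction refl r≢2
χ-vanishes {suc (suc (suc _))} _ _ = refl

[1+i]-j≡[i-j]+1 : ∀ i j → (1ℤ ℤ.+ i) - j ≡ (i - j) ℤ.+ 1ℤ
[1+i]-j≡[i-j]+1 = ℤ.solve-∀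

i-[1+j]≡[i-j]-1 : ∀ i j → i - (1ℤ ℤ.+ j) ≡ (i - j) ℤ.+ -1ℤ
i-[1+j]≡[i-j]-1 = ℤ.solve-∀

Δ[1+n]≡Δ[n]+χ : ∀ n → Δ (suc n) ≡ Δ n ℤ.+ χ (s n % 3)
Δ[1+n]≡Δ[n]+χ n with s n % 3 ≟ 1 | s n % 3 ≟ 2
... | yes r≡1 | yes r≡2 = contradiction (trans (sym r≡1) r≡2) λ ()
... | yes r≡1 | no _    rewrite r≡1 = [1+i]-j≡[i-j]+1 (+ T n 1) (+ T n 2)
... | no _    | yes r≡2 rewrite r≡2 = i-[1+j]≡[i-j]-1 (+ T n 1) (+ T n 2)
... | no r≢1  | no r≢2  rewrite χ-vanishes r≢1 r≢2 = sym (ℤ.+-identityʳ (Δ n))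

δ : ℕ → ℕ → ℕ
δ 0 2 = 3
δ 1 _ = 1
δ 2 _ = 2
δ _ _ = 0

δ-step : ∀ {a b c} → Residue₃ a → Residue₃ b → Residue₃ c →
         (b ≡ 0 → a ≢ 0 × (a + c) % 3 ≡ 0) →
         + δ a b ℤ.+ χ a ℤ.+ χ ((a + b) % 3) ≡ + δ b c
δ-step 0₃ 1₃ _ _ = refl
δ-step 1₃ 1₃ _ _ = refl
δ-step 2₃ 1₃ _ _ = refl
δ-step 0₃ 2₃ _ _ = refl
δ-step 1₃ 2₃ _ _ = refl
δ-step 2₃ 2₃ _ _ = refl
δ-step 1₃ 0₃ 2₃ _ = refl
δ-step 2₃ 0₃ 1₃ _ = refl
δ-step 0₃ 0₃ _  h = contradiction refl (proj₁ (h refl))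
δ-step 1₃ 0₃ 0₃ h = case proj₂ (h refl) of λ ()
δ-step 1₃ 0₃ 1₃ h = case proj₂ (h refl) of λ ()
δ-step 2₃ 0₃ 0₃ h = case proj₂ (h refl) of λ ()
δ-step 2₃ 0₃ 2₃ h = case proj₂ (h refl) of λ ()

Δ[2m]≡δ : ∀ m → Δ (2 * m) ≡ + δ (s m % 3) (s (suc m) % 3)
Δ[1+2m]≡δ+χ : ∀ m → Δ (suc (2 * m)) ≡ + δ (s m % 3) (s (suc m) % 3) ℤ.+ χ (s m % 3)

Δ[2m]≡δ zero = refl
Δ[2m]≡δ (suc m) = begin
  Δ (2 * suc m)                                 ≡⟨ cong Δ (*-suc 2 m) ⟩
  Δ (suc (suc (2 * m)))                         ≡⟨ Δ[1+n]≡Δ[n]+χ (suc (2 * m)) ⟩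
  Δ (suc (2 * m)) ℤ.+ χ (s (suc (2 * m)) % 3)   ≡⟨ cong₂ ℤ._+_ (Δ[1+2m]≡δ+χ m) (cong χ s[1+2m]%3) ⟩
  + δ a b ℤ.+ χ a ℤ.+ χ ((a + b) % 3)           ≡⟨ δ-step (residue₃ (s m)) (residue₃ (s (suc m)))
                                                          (residue₃ (s (suc (suc m))))
                                                          (neighbours-of-multiple-of-3 m) ⟩
  + δ b (s (suc (suc m)) % 3)                   ∎
  where
  a = s m % 3
  b = s (suc m) % 3
  s[1+2m]%3 : s (suc (2 * m)) % 3 ≡ (a + b) % 3
  s[1+2m]%3 = trans (cong (_% 3) (s[1+2n]≡s[n]+s[1+n] m)) (%-distribˡ-+ (s m) (s (suc m)) 3)
  open ≡-Reasoning

Δ[1+2m]≡δ+χ m = begin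
  Δ (suc (2 * m))                                            ≡⟨ Δ[1+n]≡Δ[n]+χ (2 * m) ⟩
  Δ (2 * m) ℤ.+ χ (s (2 * m) % 3)                            ≡⟨ cong₂ ℤ._+_ (Δ[2m]≡δ m) (cong (χ ∘ (_% 3)) (s[2n]≡s[n] m)) ⟩
  + δ (s m % 3) (s (suc m) % 3) ℤ.+ χ (s m % 3)              ∎
  where open ≡-Reasoning

Between0And3 : ℤ → Set
Between0And3 z = (z ≡ + 0) ⊎ (z ≡ + 1) ⊎ (z ≡ + 2) ⊎ (z ≡ + 3)

δ-between0And3 : ∀ {a b} → Residue₃ a → Residue₃ b →
                 Between0And3 (+ δ a b) × Between0And3 (+ δ a b ℤ.+ χ a)
δ-between0And3 0₃ 0₃ = inj₁ refl , inj₁ refl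
δ-between0And3 0₃ 1₃ = inj₁ refl , inj₁ refl
δ-between0And3 0₃ 2₃ = inj₂ (inj₂ (inj₂ refl)) , inj₂ (inj₂ (inj₂ refl))
δ-between0And3 1₃ _  = inj₂ (inj₁ refl) , inj₂ (inj₂ (inj₁ refl))
δ-between0And3 2₃ _  = inj₂ (inj₂ (inj₁ refl)) , inj₂ (inj₁ refl)

Δ-between0And3 : ∀ n → Between0And3 (Δ n)
Δ-between0And3 n with parity n
... | even m = subst Between0And3 (sym (Δ[2m]≡δ m))
                 (proj₁ (δ-between0And3 (residue₃ (s m)) (residue₃ (s (suc m)))))
... | odd m  = subst Between0And3 (sym (Δ[1+2m]≡δ+χ m))
                 (proj₂ (δ-between0And3 (residue₃ (s m)) (residue₃ (s (suc m)))))

Δ-at-residues : ∀ m {a b} → s m % 3 ≡ a → s (m + 1) % 3 ≡ b →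
                (Δ (2 * m) ≡ + δ a b) × (Δ (2 * m + 1) ≡ + δ a b ℤ.+ χ a)
Δ-at-residues m refl refl rewrite +-comm m 1 | +-comm (2 * m) 1 = Δ[2m]≡δ m , Δ[1+2m]≡δ+χ m

theorem5p6 :
    ((n : ℕ) → (Δ n ≡ + 0) ⊎ (Δ n ≡ + 1) ⊎ (Δ n ≡ + 2) ⊎ (Δ n ≡ + 3))
    × ((m : ℕ) →
        ((s m % 3 ≡ 0 → s (m + 1) % 3 ≡ 1 → (Δ (2 * m) ≡ + 0) × (Δ (2 * m + 1) ≡ + 0))
        × (s m % 3 ≡ 0 → s (m + 1) % 3 ≡ 2 → (Δ (2 * m) ≡ + 3) × (Δ (2 * m + 1) ≡ + 3))
        × (s m % 3 ≡ 1 → (Δ (2 * m) ≡ + 1) × (Δ (2 * m + 1) ≡ + 2))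
        × (s m % 3 ≡ 2 → (Δ (2 * m) ≡ + 2) × (Δ (2 * m + 1) ≡ + 1))))
theorem5p6 = Δ-between0And3 , λ m →
    Δ-at-residues m
  , Δ-at-residues m
  , (λ s[m]%3≡1 → Δ-at-residues m s[m]%3≡1 refl)
  , (λ s[m]%3≡2 → Δ-at-residues m s[m]%3≡2 refl)
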